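{- Let $a$ be a weak composition. Then $\mathrm{col}(\mathrm{key}(a))$ is Knuth-equivalent to $\mathrm{col}_R(\mathrm{key}(a))$.
   Context: $\mathrm{key}(a)$ is the unique key of weight $a$, where a key is a semistandard Young tableau (French notation) in which the entries of column $i+1$ form a subset of the entries of column $i$. For a tableau $T$, $\mathrm{col}(T)$ is the column reading word obtained by reading entries down each column (top to bottom), columns from left to right, and $\mathrm{col}_R(T)$ reads each column top to bottom starting with the rightmost column and moving leftward. Knuth equivalence is generated by $xzy\sim zxy$ for $x\le y<z$ and $yxz\sim yzx$ for $x<y\le z$. -}

module Defs where

open import Data.Nat using (ℕ; zero; suc; _≤_; _<_; _≤ᵇ_; _⊔_)
open import Data.List using (List; []; _∷_; _++_; map; reverse; concatMap; foldr; upTo)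
open import Data.Bool using (if_then_else_)

WeakComposition : Set
WeakComposition = List ℕ

-- A tableau (French notation) is stored as its list of columns, left to right;
-- each column is listed bottom to top (so strictly increasing for a key).
Column : Set
Column = List ℕ

Tableau : Set
Tableau = List Column

colEntries : ℕ → ℕ → List ℕ → Column
colEntries j i [] = []
colEntries j i (ai ∷ as) =
  if j ≤ᵇ ai then i ∷ colEntries j (suc i) as else colEntries j (suc i) as

maxPart : WeakComposition → ℕ
maxPart = foldr _⊔_ 0

-- key(a): the key of weight a; column j (j = 1 … max a) is {i : aᵢ ≥ j},
-- so i appears in exactly aᵢ columns (weight a) and columns are nested.
key : WeakComposition → Tableau
key a = map (λ k → colEntries (suc k) 1 a) (upTo (maxPart a))

col : Tableau → List ℕ
col T = concatMap reverse T

colR : Tableau → List ℕ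
colR T = concatMap reverse (reverse T)

data KnuthStep : List ℕ → List ℕ → Set where
  kxzy : ∀ (u v : List ℕ) {x y z : ℕ} → x ≤ y → y < z →
         KnuthStep (u ++ x ∷ z ∷ y ∷ v) (u ++ z ∷ x ∷ y ∷ v)
  kyxz : ∀ (u v : List ℕ) {x y z : ℕ} → x < y → y ≤ z →
         KnuthStep (u ++ y ∷ x ∷ z ∷ v) (u ++ y ∷ z ∷ x ∷ v)

data _≡K_ : List ℕ → List ℕ → Set where
  krefl  : ∀ {w} → w ≡K w
  kstep  : ∀ {w w′} → KnuthStep w w′ → w ≡K w′
  ksym   : ∀ {w w′} → w ≡K w′ → w′ ≡K w
  ktrans : ∀ {w w′ w″} → w ≡K w′ → w′ ≡K w″ → w ≡K w″

infix 4 _≡K_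

-- Read top to bottom, every column of a key is strictly decreasing, and each
-- column contains all later ones. If u is strictly decreasing and x occurs in u,
-- then u x ≡K x u: the final x slides left until it sits just behind the
-- occurrence of x already in u (relations yxz ∼ yzx), and that earlier x then
-- slides to the front (relations xzy ∼ zxy). Hence u v ≡K v u whenever every
-- letter of v occurs in u, and the columns can be reversed one at a time.
module Submission where

open import Defs
open import Data.Nat using (ℕ; suc; _≤_; _<_; _>_; _≤ᵇ_; s≤s)
open import Data.Nat.Properties using (≤-refl; ≤-trans; <⇒≤; ≤ᵇ⇒≤; ≤⇒≤ᵇ)
open import Data.List using (List; []; _∷_; _++_; _∷ʳ_; map; reverse; concat; [_])
open import Data.List.Properties using (++-assoc; ++-identityʳ; unfold-reverse; concat-++; reverse-map)
open import Data.List.Relation.Unary.All as All using (All; []; _∷_)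
import Data.List.Relation.Unary.All.Properties as All
open import Data.List.Relation.Unary.AllPairs as AllPairs using (AllPairs; []; _∷_)
import Data.List.Relation.Unary.AllPairs.Properties as AllPairs
open import Data.List.Relation.Unary.Any using (here; there)
import Data.List.Relation.Unary.Any.Properties as Any
open import Data.List.Membership.Propositional using (_∈_)
open import Data.List.Membership.Propositional.Properties using (∈-∃++; ∈-concat⁻′)
open import Data.List.Relation.Binary.Subset.Propositional using (_⊆_)
open import Data.List.Relation.Binary.Subset.Propositional.Properties using (All-resp-⊇)
open import Data.Bool using (true; false; T)
open import Data.Empty using (⊥-elim)
open import Data.Product using (_×_; _,_)
open import Data.Unit using (tt)
open import Function using (_∘_; flip)
open import Relation.Binary.Bundles using (Setoid)
open import Relation.Binary.PropositionalEquality using (_≡_; refl; sym; cong; subst; subst₂)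
import Relation.Binary.Reasoning.Setoid as SetoidReasoning

All-reverse⁺ : ∀ {A : Set} {P : A → Set} {xs} → All P xs → All P (reverse xs)
All-reverse⁺ = All-resp-⊇ Any.reverse⁻

AllPairs-reverse⁺ : ∀ {A : Set} {R : A → A → Set} {xs} → AllPairs R xs → AllPairs (flip R) (reverse xs)
AllPairs-reverse⁺ [] = []
AllPairs-reverse⁺ {R = R} {x ∷ xs} (x-R-xs ∷ Rxs) =
  subst (AllPairs (flip R)) (sym (unfold-reverse x xs))
    (AllPairs.++⁺ (AllPairs-reverse⁺ Rxs) ([] ∷ []) (All.map (_∷ []) (All-reverse⁺ x-R-xs)))

AllPairs-++⁻ : ∀ {A : Set} {R : A → A → Set} xs {ys} → AllPairs R (xs ++ ys) →
               AllPairs R xs × All (λ x → All (R x) ys) xs × AllPairs R ys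
AllPairs-++⁻ [] Rys = [] , [] , Rys
AllPairs-++⁻ (x ∷ xs) (x-R-xs++ys ∷ R-xs++ys) with AllPairs-++⁻ xs R-xs++ys
... | Rxs , xs-R-ys , Rys =
  All.++⁻ˡ xs x-R-xs++ys ∷ Rxs , All.++⁻ʳ xs x-R-xs++ys ∷ xs-R-ys , Rys

concat-⊆ : ∀ {A : Set} {u : List A} {vs} → All (_⊆ u) vs → concat vs ⊆ u
concat-⊆ {vs = vs} vs⊆u x∈concat with ∈-concat⁻′ vs x∈concat
... | v , x∈v , v∈vs = All.lookup vs⊆u v∈vs x∈v

Decreasing : List ℕ → Set
Decreasing = AllPairs _>_

≡K-setoid : Setoid _ _
≡K-setoid = record
  { Carrier       = List ℕ
  ; _≈_           = _≡K_
  ; isEquivalence = record { refl = krefl ; sym = ksym ; trans = ktrans }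
  }

open SetoidReasoning ≡K-setoid

≡⇒≡K : ∀ {w w′} → w ≡ w′ → w ≡K w′
≡⇒≡K refl = krefl

knuthStep-++ˡ : ∀ u {w w′} → KnuthStep w w′ → KnuthStep (u ++ w) (u ++ w′)
knuthStep-++ˡ u (kxzy u′ v x≤y y<z) =
  subst₂ KnuthStep (++-assoc u u′ _) (++-assoc u u′ _) (kxzy (u ++ u′) v x≤y y<z)
knuthStep-++ˡ u (kyxz u′ v x<y y≤z) =
  subst₂ KnuthStep (++-assoc u u′ _) (++-assoc u u′ _) (kyxz (u ++ u′) v x<y y≤z)

knuthStep-++ʳ : ∀ t {w w′} → KnuthStep w w′ → KnuthStep (w ++ t) (w′ ++ t)
knuthStep-++ʳ t (kxzy u v x≤y y<z) =
  subst₂ KnuthStep (sym (++-assoc u _ t)) (sym (++-assoc u _ t)) (kxzy u (v ++ t) x≤y y<z)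
knuthStep-++ʳ t (kyxz u v x<y y≤z) =
  subst₂ KnuthStep (sym (++-assoc u _ t)) (sym (++-assoc u _ t)) (kyxz u (v ++ t) x<y y≤z)

≡K-++ˡ : ∀ u {w w′} → w ≡K w′ → u ++ w ≡K u ++ w′
≡K-++ˡ u krefl        = krefl
≡K-++ˡ u (kstep s)    = kstep (knuthStep-++ˡ u s)
≡K-++ˡ u (ksym e)     = ksym (≡K-++ˡ u e)
≡K-++ˡ u (ktrans e f) = ktrans (≡K-++ˡ u e) (≡K-++ˡ u f)

≡K-++ʳ : ∀ t {w w′} → w ≡K w′ → w ++ t ≡K w′ ++ t
≡K-++ʳ t krefl        = krefl
≡K-++ʳ t (kstep s)    = kstep (knuthStep-++ʳ t s)
≡K-++ʳ t (ksym e)     = ksym (≡K-++ʳ t e)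
≡K-++ʳ t (ktrans e f) = ktrans (≡K-++ʳ t e) (≡K-++ʳ t f)

moveBehindHead : ∀ {x y} s → y ≤ x → Decreasing (y ∷ s) → y ∷ s ++ [ x ] ≡K y ∷ x ∷ s
moveBehindHead          []      y≤x _                      = krefl
moveBehindHead {x} {y} (e ∷ s) y≤x ((y>e ∷ _) ∷ dec-e∷s) = begin
  y ∷ e ∷ s ++ [ x ]  ≈⟨ ≡K-++ˡ [ y ] (moveBehindHead s (≤-trans (<⇒≤ y>e) y≤x) dec-e∷s) ⟩
  y ∷ e ∷ x ∷ s       ≈⟨ kstep (kyxz [] s y>e y≤x) ⟩
  y ∷ x ∷ e ∷ s       ∎

moveToFront : ∀ {x c} p t → Decreasing p → All (c <_) p → x ≤ c →
              p ++ x ∷ c ∷ t ≡K x ∷ p ++ c ∷ t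
moveToFront []          t _ _ _ = krefl
moveToFront (d ∷ [])    t _ (c<d ∷ []) x≤c = ksym (kstep (kxzy [] t x≤c c<d))
moveToFront {x} {c} (d ∷ e ∷ p) t ((d>e ∷ _) ∷ dec-e∷p) (_ ∷ c<e ∷ c<p) x≤c = begin
  d ∷ e ∷ p ++ x ∷ c ∷ t  ≈⟨ ≡K-++ˡ [ d ] (moveToFront (e ∷ p) t dec-e∷p (c<e ∷ c<p) x≤c) ⟩
  d ∷ x ∷ e ∷ p ++ c ∷ t  ≈⟨ ksym (kstep (kxzy [] _ (≤-trans x≤c (<⇒≤ c<e)) d>e)) ⟩
  x ∷ d ∷ e ∷ p ++ c ∷ t  ∎

decreasing-∷ʳ≡K-∷ : ∀ {x u} → Decreasing u → x ∈ u → u ∷ʳ x ≡K x ∷ u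
decreasing-∷ʳ≡K-∷ {x} dec x∈u with ∈-∃++ x∈u
... | p , s , refl with AllPairs-++⁻ p dec
...   | dec-p , p>x∷s , dec-x∷s = begin
  (p ++ x ∷ s) ++ [ x ]  ≡⟨ ++-assoc p (x ∷ s) [ x ] ⟩
  p ++ x ∷ s ++ [ x ]    ≈⟨ ≡K-++ˡ p (moveBehindHead s ≤-refl dec-x∷s) ⟩
  p ++ x ∷ x ∷ s         ≈⟨ moveToFront p s dec-p (All.map All.head p>x∷s) ≤-refl ⟩
  x ∷ p ++ x ∷ s         ∎

decreasing-++-comm : ∀ {u} v → Decreasing u → v ⊆ u → u ++ v ≡K v ++ u
decreasing-++-comm {u} []      _   _   = ≡⇒≡K (++-identityʳ u)
decreasing-++-comm {u} (x ∷ v) dec x∷v⊆u = begin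
  u ++ x ∷ v      ≡⟨ ++-assoc u [ x ] v ⟨
  (u ∷ʳ x) ++ v   ≈⟨ ≡K-++ʳ v (decreasing-∷ʳ≡K-∷ dec (x∷v⊆u (here refl))) ⟩
  x ∷ u ++ v      ≈⟨ ≡K-++ˡ [ x ] (decreasing-++-comm v dec (x∷v⊆u ∘ there)) ⟩
  x ∷ v ++ u      ∎

concat≡K-concat-reverse : ∀ ws → All Decreasing ws → AllPairs (flip _⊆_) ws →
                          concat ws ≡K concat (reverse ws)
concat≡K-concat-reverse []       _             _                   = krefl
concat≡K-concat-reverse (w ∷ ws) (dec-w ∷ dec) (ws⊆w ∷ nested) = begin
  w ++ concat ws                      ≈⟨ ≡K-++ˡ w (concat≡K-concat-reverse ws dec nested) ⟩
  w ++ concat (reverse ws)            ≈⟨ decreasing-++-comm _ dec-w (concat-⊆ (All-reverse⁺ ws⊆w)) ⟩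
  concat (reverse ws) ++ w            ≡⟨ cong (concat (reverse ws) ++_) (++-identityʳ w) ⟨
  concat (reverse ws) ++ concat [ w ] ≡⟨ concat-++ (reverse ws) [ w ] ⟩
  concat (reverse ws ∷ʳ w)            ≡⟨ cong concat (unfold-reverse w ws) ⟨
  concat (reverse (w ∷ ws))           ∎

col≡K-colR : ∀ T → All (AllPairs _<_) T → AllPairs (flip _⊆_) T → col T ≡K colR T
col≡K-colR T increasing nested = begin
  concat (map reverse T)            ≈⟨ concat≡K-concat-reverse _ decreasing nested-reversed ⟩
  concat (reverse (map reverse T))  ≡⟨ cong concat (reverse-map reverse T) ⟨
  concat (map reverse (reverse T))  ∎
  where
  decreasing : All Decreasing (map reverse T)
  decreasing = All.map⁺ (All.map AllPairs-reverse⁺ increasing)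
  nested-reversed : AllPairs (flip _⊆_) (map reverse T)
  nested-reversed = AllPairs.map⁺ (AllPairs.map (λ c′⊆c {x} → Any.reverse⁺ ∘ c′⊆c {x} ∘ Any.reverse⁻) nested)

colEntries-≥ : ∀ j i a → All (i ≤_) (colEntries j i a)
colEntries-≥ j i []        = []
colEntries-≥ j i (ai ∷ as) with j ≤ᵇ ai
... | true  = ≤-refl ∷ All.map <⇒≤ (colEntries-≥ j (suc i) as)
... | false = All.map <⇒≤ (colEntries-≥ j (suc i) as)

colEntries-increasing : ∀ j i a → AllPairs _<_ (colEntries j i a)
colEntries-increasing j i []        = []
colEntries-increasing j i (ai ∷ as) with j ≤ᵇ ai
... | true  = colEntries-≥ j (suc i) as ∷ colEntries-increasing j (suc i) as
... | false = colEntries-increasing j (suc i) as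

colEntries-antitone : ∀ {j k} i a → j ≤ k → colEntries k i a ⊆ colEntries j i a
colEntries-antitone i [] j≤k ()
colEntries-antitone {j} {k} i (ai ∷ as) j≤k x∈col
  with k ≤ᵇ ai in k≤ai | j ≤ᵇ ai in j≤ai | x∈col
... | true  | true  | here x≡i   = here x≡i
... | true  | true  | there x∈ks = there (colEntries-antitone (suc i) as j≤k x∈ks)
... | true  | false | _ = ⊥-elim (subst T j≤ai (≤⇒≤ᵇ (≤-trans j≤k (≤ᵇ⇒≤ k ai (subst T (sym k≤ai) tt)))))
... | false | true  | x∈ks = there (colEntries-antitone (suc i) as j≤k x∈ks)
... | false | false | x∈ks = colEntries-antitone (suc i) as j≤k x∈ks

key-increasing : ∀ a → All (AllPairs _<_) (key a)
key-increasing a =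
  All.map⁺ (All.applyUpTo⁺₂ _ (maxPart a) (λ k → colEntries-increasing (suc k) 1 a))

key-nested : ∀ a → AllPairs (flip _⊆_) (key a)
key-nested a =
  AllPairs.map⁺ (AllPairs.applyUpTo⁺₁ _ (maxPart a) (λ i<j _ → colEntries-antitone 1 a (<⇒≤ (s≤s i<j))))

mainTheorem19 : (a : WeakComposition) → col (key a) ≡K colR (key a)
mainTheorem19 a = col≡K-colR (key a) (key-increasing a) (key-nested a)
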